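{- Let $k\ge1$, let $A$ be a $k\times k$ strictly upper triangular matrix of integers, and suppose every integer sequence $\lambda=(\lambda_1,\ldots,\lambda_k)$ with $\lambda_i \ge \sum_{j=i+1}^{k} A[i,j]\lambda_j$ for all $1\le i\le k$ has all entries nonnegative. Given a set $S\subseteq\{1,\ldots,k\}$, let $P_A(n,k;S)$ be the set of integer sequences $\lambda=(\lambda_1,\ldots,\lambda_k)$ of weight $n$ satisfying, for $1\le i\le k$, \[\lambda_i=\sum_{j=i+1}^k A[i,j]\lambda_j \ \text{ if } i\in S,\qquad \lambda_i\ge\sum_{j=i+1}^k A[i,j]\lambda_j\ \text{ if } i\notin S.\] Then \[\sum_{n=0}^\infty |P_A(n,k;S)|\,q^n=\prod_{i\in\{1,\ldots,k\}\setminus S}\frac{1}{1-q^{b_i}},\] where $b_i=\sum_j B[j,i]$ is the $i$-th column sum of $B=(I-A)^{ -1}$.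
   Context: A strictly upper triangular matrix $A$ has $A[i,j]=0$ for $i\ge j$; the weight of a sequence is the sum of its entries. -}

module Defs where

open import Data.Nat as ℕ using (ℕ; zero; suc; _∸_; _<ᵇ_)
open import Data.Nat.Divisibility using (_∣?_)
open import Data.Integer as ℤ using (ℤ; +_; -[1+_]; _≤_)
open import Data.Fin using (Fin; toℕ; _≟_) renaming (zero to fzero; suc to fsuc)
open import Data.Fin.Subset using (Subset; _∈_; _∉_)
open import Data.Fin.Subset.Properties using (_∈?_)
open import Data.Vec using (Vec; lookup)
open import Data.Bool using (if_then_else_)
open import Data.Product using (_×_)
open import Relation.Nullary using (does)
open import Relation.Binary.PropositionalEquality using (_≡_)

-- Integer matrices k×k (indices 0-based: Fin k stands for {1,…,k}).
Matrix : ℕ → Set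
Matrix k = Fin k → Fin k → ℤ

sumℤ : (n : ℕ) → (Fin n → ℤ) → ℤ
sumℤ zero    f = + 0
sumℤ (suc n) f = f fzero ℤ.+ sumℤ n (λ i → f (fsuc i))

sumℕ : (n : ℕ) → (Fin n → ℕ) → ℕ
sumℕ zero    f = 0
sumℕ (suc n) f = f fzero ℕ.+ sumℕ n (λ i → f (fsuc i))

StrictlyUpperTriangular : {k : ℕ} → Matrix k → Set
StrictlyUpperTriangular {k} A = ∀ (i j : Fin k) → toℕ j ℕ.≤ toℕ i → A i j ≡ + 0

δ : {k : ℕ} → Fin k → Fin k → ℤ
δ i j = if does (i ≟ j) then + 1 else + 0

IsInverseOfIMinus : {k : ℕ} → Matrix k → Matrix k → Set
IsInverseOfIMinus {k} A B =
  ∀ (i j : Fin k) → sumℤ k (λ l → (δ i l ℤ.- A i l) ℤ.* B l j) ≡ δ i j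

colSum : {k : ℕ} → Matrix k → Fin k → ℤ
colSum {k} B i = sumℤ k (λ j → B j i)

rowTail : {k : ℕ} → Matrix k → Vec ℤ k → Fin k → ℤ
rowTail {k} A λs i =
  sumℤ k (λ j → if toℕ i <ᵇ toℕ j then A i j ℤ.* lookup λs j else + 0)

weight : {k : ℕ} → Vec ℤ k → ℤ
weight {k} λs = sumℤ k (lookup λs)

InP : {k : ℕ} → Matrix k → ℕ → Subset k → Vec ℤ k → Set
InP {k} A n S λs =
  weight λs ≡ + n
  × (∀ (i : Fin k) → i ∈ S → lookup λs i ≡ rowTail A λs i)
  × (∀ (i : Fin k) → i ∉ S → rowTail A λs i ≤ lookup λs i)

-- Formal power series in q with ℕ coefficients: coefficient functions.

Series : Set
Series = ℕ → ℕ

oneS : Series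
oneS zero    = 1
oneS (suc _) = 0

_⊛_ : Series → Series → Series
(f ⊛ g) n = sumℕ (suc n) (λ m → f (toℕ m) ℕ.* g (n ∸ toℕ m))

-- the power series 1/(1 - q^b) = Σ_m q^{m b}, for b a positive integer
-- (coefficient 1 at multiples of b). Only used for b ≥ 1; the value for
-- b ≤ 0 (where 1/(1-q^b) is not a power series in q) is set to 0.
geomInv : ℤ → Series
geomInv (+ suc b) n = if does (suc b ∣? n) then 1 else 0
geomInv (+ zero)  n = 0
geomInv -[1+ _ ]  n = 0

prodS : (k : ℕ) → (Fin k → Series) → Series
prodS zero    F = oneS
prodS (suc k) F = F fzero ⊛ prodS k (λ i → F (fsuc i))

prodOutside : {k : ℕ} → Subset k → (Fin k → ℤ) → Series
prodOutside {k} S b = prodS k (λ i → if does (i ∈? S) then oneS else geomInv (b i))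

-- Put μ = (I − A)λ, i.e. μᵢ = λᵢ − Σ_{j>i} A[i,j] λⱼ.  The hypothesis says that I − A is
-- a monotone matrix (μ ≥ 0 forces λ ≥ 0), so it is injective; as (I − A)B = I, the sequences
-- in P_A(n,k;S) are exactly the λ = Bμ with μ ∈ ℕᵏ vanishing on S and Σⱼ bⱼ μⱼ = n.  Each bⱼ
-- is a positive integer, because the j-th column of B is nonnegative by monotonicity and
-- nonzero.  Counting such μ is extracting the coefficient of qⁿ from ∏_{j ∉ S} Σ_m q^{bⱼ m}.
module Submission where

open import Defs
open import Data.Nat as ℕ using (ℕ; zero; suc; _≤_; _∸_; _<ᵇ_)
import Data.Nat.Properties as ℕ
open import Data.Nat.Divisibility using (_∣_; _∣?_; divides)
open import Data.Integer as ℤ using (ℤ; +_; -[1+_]; _+_; _*_; -_; _-_; ∣_∣)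
  renaming (_≤_ to _≤ℤ_)
import Data.Integer.Properties as ℤ
open import Data.Fin as Fin using (Fin; toℕ; fromℕ<; _≟_) renaming (zero to fzero; suc to fsuc)
import Data.Fin.Properties as Fin
open import Data.Fin.Subset using (Subset; _∉_) renaming (_∈_ to _∈ₛ_)
open import Data.Fin.Subset.Properties using (_∈?_)
open import Data.Vec using (Vec; []; _∷_; lookup; tabulate)
open import Data.Vec.Properties
  using (lookup∘tabulate; tabulate∘lookup; tabulate-cong; ∷-injective)
open import Data.List using (List; []; _∷_; _++_; [_]; length; map; cartesianProductWith)
open import Data.List.Properties using (length-++; length-map)
open import Data.List.Membership.Propositional using (_∈_)
open import Data.List.Membership.Propositional.Properties
  using ( ∈-++⁺ˡ; ∈-++⁺ʳ; ∈-++⁻; ∈-map⁺; ∈-map⁻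
        ; ∈-cartesianProductWith⁺; ∈-cartesianProductWith⁻)
open import Data.List.Relation.Unary.Any using (here)
open import Data.List.Relation.Unary.AllPairs using ([]; _∷_)
open import Data.List.Relation.Unary.All using ([])
open import Data.List.Relation.Unary.Unique.Propositional using (Unique)
import Data.List.Relation.Unary.Unique.Propositional.Properties as Unique
open import Data.Product using (Σ; _×_; _,_; proj₁; proj₂)
open import Data.Sum using (inj₁; inj₂)
open import Data.Bool using (true; false; T; if_then_else_)
open import Function using (_∘_)
open import Function.Bundles using (_⇔_; mk⇔)
open import Relation.Nullary using (Dec; yes; no; does; contradiction)
open import Relation.Binary.PropositionalEquality hiding ([_])
open import Algebra.Properties.Ring ℤ.+-*-ring using (x[y-z]≈xy-xz; [y-z]x≈yx-zx)
open import Algebra.Properties.Semiring.Sum ℤ.+-*-semiring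
  using (sum; sum-cong-≗; sum-replicate-zero; ∑-comm; ∑-distrib-+; *-distribˡ-sum; *-distribʳ-sum)

private variable
  X : Set

sumℤ≡sum : ∀ n (f : Fin n → ℤ) → sumℤ n f ≡ sum f
sumℤ≡sum zero    f = refl
sumℤ≡sum (suc n) f = cong (_+_ (f fzero)) (sumℤ≡sum n (f ∘ fsuc))

sumℕ-cong : ∀ n {f g : Fin n → ℕ} → (∀ i → f i ≡ g i) → sumℕ n f ≡ sumℕ n g
sumℕ-cong zero    f≗g = refl
sumℕ-cong (suc n) f≗g = cong₂ ℕ._+_ (f≗g fzero) (sumℕ-cong n (f≗g ∘ fsuc))

sum-+ : ∀ n (f : Fin n → ℕ) → sum (λ i → + f i) ≡ + sumℕ n f
sum-+ zero    f = refl
sum-+ (suc n) f = trans (cong (_+_ (+ f fzero)) (sum-+ n (f ∘ fsuc))) (sym (ℤ.pos-+ (f fzero) _))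

sum-neg : ∀ {n} (f : Fin n → ℤ) → sum (λ i → - f i) ≡ - sum f
sum-neg f = begin
  sum (λ i → - f i)         ≡⟨ sum-cong-≗ (λ i → sym (ℤ.-1*i≡-i (f i))) ⟩
  sum (λ i → ℤ.-1ℤ * f i)   ≡⟨ *-distribˡ-sum ℤ.-1ℤ f ⟨
  ℤ.-1ℤ * sum f             ≡⟨ ℤ.-1*i≡-i (sum f) ⟩
  - sum f                   ∎
  where open ≡-Reasoning

sum-distrib-- : ∀ {n} (f g : Fin n → ℤ) → sum (λ i → f i - g i) ≡ sum f - sum g
sum-distrib-- f g = trans (∑-distrib-+ f (λ i → - g i)) (cong (_+_ (sum f)) (sum-neg g))

sum-δˡ : ∀ {n} (i : Fin n) (x : Fin n → ℤ) → sum (λ l → δ i l * x l) ≡ x i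
sum-δˡ {suc n} fzero x = begin
  + 1 * x fzero + sum (λ l → + 0 * x (fsuc l))
    ≡⟨ cong₂ _+_ (ℤ.*-identityˡ (x fzero)) (sum-cong-≗ (λ l → ℤ.*-zeroˡ (x (fsuc l)))) ⟩
  x fzero + sum {n} (λ _ → + 0)
    ≡⟨ cong (_+_ (x fzero)) (sum-replicate-zero n) ⟩
  x fzero + + 0
    ≡⟨ ℤ.+-identityʳ (x fzero) ⟩
  x fzero ∎
  where open ≡-Reasoning
sum-δˡ {suc n} (fsuc i) x = trans (ℤ.+-identityˡ _) (sum-δˡ i (x ∘ fsuc))

sum-nonneg : ∀ {n} (f : Fin n → ℤ) → (∀ i → + 0 ≤ℤ f i) → + 0 ≤ℤ sum f
sum-nonneg {zero}  f f≥0 = ℤ.≤-refl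
sum-nonneg {suc n} f f≥0 = ℤ.+-mono-≤ (f≥0 fzero) (sum-nonneg (f ∘ fsuc) (f≥0 ∘ fsuc))

≤-sum : ∀ {n} (f : Fin n → ℤ) → (∀ i → + 0 ≤ℤ f i) → ∀ i → f i ≤ℤ sum f
≤-sum f f≥0 fzero    = ℤ.i≤i+j (f fzero) _ {{ℤ.nonNegative (sum-nonneg (f ∘ fsuc) (f≥0 ∘ fsuc))}}
≤-sum f f≥0 (fsuc i) =
  ℤ.≤-trans (≤-sum (f ∘ fsuc) (f≥0 ∘ fsuc) i) (ℤ.i≤j+i _ (f fzero) {{ℤ.nonNegative (f≥0 fzero)}})

δ-diag : ∀ {n} (i : Fin n) → δ i i ≡ + 1
δ-diag i with i ≟ i
... | yes _  = refl
... | no i≢i = contradiction refl i≢i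

δ-nonneg : ∀ {n} (i j : Fin n) → + 0 ≤ℤ δ i j
δ-nonneg i j with i ≟ j
... | yes _ = ℤ.+≤+ ℕ.z≤n
... | no _  = ℤ.≤-refl

-- Matrices acting on integer vectors

module _ {k : ℕ} where

  infixr 7 _·_
  infixl 8 _∙_

  _·_ : Matrix k → (Fin k → ℤ) → Fin k → ℤ
  (M · x) i = sum (λ l → M i l * x l)

  _∙_ : Matrix k → Matrix k → Matrix k
  (M ∙ N) i j = sum (λ l → M i l * N l j)

  I-_ : Matrix k → Matrix k
  (I- A) i j = δ i j - A i j

  Monotone : Matrix k → Set
  Monotone M = ∀ x → (∀ i → + 0 ≤ℤ (M · x) i) → ∀ i → + 0 ≤ℤ x i

  RightInverse : Matrix k → Matrix k → Set
  RightInverse M B = ∀ i j → (M ∙ B) i j ≡ δ i j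

  ·-cong : ∀ M {x y} → (∀ l → x l ≡ y l) → ∀ i → (M · x) i ≡ (M · y) i
  ·-cong M x≗y i = sum-cong-≗ (λ l → cong (M i l *_) (x≗y l))

  ·-zeroʳ : ∀ M i → (M · (λ _ → + 0)) i ≡ + 0
  ·-zeroʳ M i = trans (sum-cong-≗ (λ l → ℤ.*-zeroʳ (M i l))) (sum-replicate-zero k)

  δ· : ∀ x i → (δ · x) i ≡ x i
  δ· x i = sum-δˡ i x

  ·-assoc : ∀ M N x i → (M · N · x) i ≡ (M ∙ N · x) i
  ·-assoc M N x i = begin
    sum (λ l → M i l * sum (λ j → N l j * x j))
      ≡⟨ sum-cong-≗ (λ l → *-distribˡ-sum (M i l) (λ j → N l j * x j)) ⟩
    sum (λ l → sum (λ j → M i l * (N l j * x j)))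
      ≡⟨ ∑-comm (λ l j → M i l * (N l j * x j)) ⟩
    sum (λ j → sum (λ l → M i l * (N l j * x j)))
      ≡⟨ sum-cong-≗ (λ j → sum-cong-≗ (λ l → sym (ℤ.*-assoc (M i l) (N l j) (x j)))) ⟩
    sum (λ j → sum (λ l → M i l * N l j * x j))
      ≡⟨ sum-cong-≗ (λ j → *-distribʳ-sum (x j) (λ l → M i l * N l j)) ⟨
    sum (λ j → sum (λ l → M i l * N l j) * x j) ∎
    where open ≡-Reasoning

  ·-distrib-- : ∀ M x y i → (M · (λ l → x l - y l)) i ≡ (M · x) i - (M · y) i
  ·-distrib-- M x y i = trans (sum-cong-≗ (λ l → x[y-z]≈xy-xz (M i l) (x l) (y l)))
                              (sum-distrib-- (λ l → M i l * x l) (λ l → M i l * y l))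

  I-· : ∀ A x i → ((I- A) · x) i ≡ x i - (A · x) i
  I-· A x i = begin
    sum (λ l → (δ i l - A i l) * x l)
      ≡⟨ sum-cong-≗ (λ l → [y-z]x≈yx-zx (x l) (δ i l) (A i l)) ⟩
    sum (λ l → δ i l * x l - A i l * x l)
      ≡⟨ sum-distrib-- (λ l → δ i l * x l) (λ l → A i l * x l) ⟩
    (δ · x) i - (A · x) i
      ≡⟨ cong (_- (A · x) i) (δ· x i) ⟩
    x i - (A · x) i ∎
    where open ≡-Reasoning

  monotone⇒injective : ∀ M → Monotone M →
                       ∀ x y → (∀ i → (M · x) i ≡ (M · y) i) → ∀ i → x i ≡ y i
  monotone⇒injective M mono x y Mx≗My i = ℤ.≤-antisym (≤-from (sym ∘ Mx≗My) i) (≤-from Mx≗My i)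
    where
    ≤-from : ∀ {x y} → (∀ i → (M · x) i ≡ (M · y) i) → ∀ i → y i ≤ℤ x i
    ≤-from {x} {y} Mx≗My i = ℤ.0≤i-j⇒j≤i (mono (λ l → x l - y l) M[x-y]≥0 i)
      where
      M[x-y]≥0 : ∀ i → + 0 ≤ℤ (M · (λ l → x l - y l)) i
      M[x-y]≥0 i = ℤ.≤-reflexive (sym (trans (·-distrib-- M x y i) (ℤ.i≡j⇒i-j≡0 (Mx≗My i))))

  ·-rightInverse : ∀ M B → RightInverse M B → ∀ μ i → (M · B · μ) i ≡ μ i
  ·-rightInverse M B inv μ i = begin
    (M · B · μ) i   ≡⟨ ·-assoc M B μ i ⟩
    (M ∙ B · μ) i   ≡⟨ sum-cong-≗ (λ j → cong (_* μ j) (inv i j)) ⟩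
    (δ · μ) i       ≡⟨ δ· μ i ⟩
    μ i             ∎
    where open ≡-Reasoning

  colSum-positive : ∀ M B → Monotone M → RightInverse M B →
                    ∀ j → Σ ℕ λ c → colSum B j ≡ + suc c
  colSum-positive M B mono inv j =
    positive (subst (+ 0 ≤ℤ_) (sym b≡) (sum-nonneg col col≥0)) (b≢0 ∘ trans (sym b≡))
    where
    col : Fin k → ℤ
    col l = B l j
    b≡ : colSum B j ≡ sum col
    b≡ = sumℤ≡sum k col
    col≥0 : ∀ l → + 0 ≤ℤ col l
    col≥0 = mono col (λ i → subst (+ 0 ≤ℤ_) (sym (inv i j)) (δ-nonneg i j))
    b≢0 : sum col ≢ + 0
    b≢0 b≡0 = contradiction (begin
      + 1                   ≡⟨ δ-diag j ⟨
      δ j j                 ≡⟨ inv j j ⟨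
      (M · col) j           ≡⟨ ·-cong M col≡0 j ⟩
      (M · (λ _ → + 0)) j   ≡⟨ ·-zeroʳ M j ⟩
      + 0                   ∎) λ ()
      where
      open ≡-Reasoning
      col≡0 : ∀ l → col l ≡ + 0
      col≡0 l = ℤ.≤-antisym (subst (col l ≤ℤ_) b≡0 (≤-sum col col≥0 l)) (col≥0 l)
    positive : ∀ {z} → + 0 ≤ℤ z → z ≢ + 0 → Σ ℕ λ c → z ≡ + suc c
    positive {+ zero}  _ z≢0 = contradiction refl z≢0
    positive {+ suc c} _ _   = c , refl

  weight-· : ∀ B μ → weight (tabulate (B · μ)) ≡ sum (λ j → colSum B j * μ j)
  weight-· B μ = begin
    sumℤ k (lookup (tabulate (B · μ)))
      ≡⟨ sumℤ≡sum k _ ⟩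
    sum (lookup (tabulate (B · μ)))
      ≡⟨ sum-cong-≗ (lookup∘tabulate (B · μ)) ⟩
    sum (λ i → sum (λ j → B i j * μ j))
      ≡⟨ ∑-comm (λ i j → B i j * μ j) ⟩
    sum (λ j → sum (λ i → B i j * μ j))
      ≡⟨ sum-cong-≗ (λ j → *-distribʳ-sum (μ j) (λ i → B i j)) ⟨
    sum (λ j → sum (λ i → B i j) * μ j)
      ≡⟨ sum-cong-≗ (λ j → cong (_* μ j) (sumℤ≡sum k (λ i → B i j))) ⟨
    sum (λ j → colSum B j * μ j) ∎
    where open ≡-Reasoning

module _ {k : ℕ} (A : Matrix k) (A-upper : StrictlyUpperTriangular A) where

  rowTail≡· : ∀ λs i → rowTail A λs i ≡ (A · lookup λs) i
  rowTail≡· λs i = trans (sumℤ≡sum k _) (sum-cong-≗ upperTerm)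
    where
    upperTerm : ∀ l → (if toℕ i <ᵇ toℕ l then A i l * lookup λs l else + 0) ≡ A i l * lookup λs l
    upperTerm l with toℕ i <ᵇ toℕ l in i<ᵇl
    ... | true  = refl
    ... | false = cong (_* lookup λs l) (sym (A-upper i l (ℕ.≮⇒≥ (subst T i<ᵇl ∘ ℕ.<⇒<ᵇ))))

  I-A·≡ : ∀ λs i → ((I- A) · lookup λs) i ≡ lookup λs i - rowTail A λs i
  I-A·≡ λs i = trans (I-· A (lookup λs) i) (cong (_-_ (lookup λs i)) (sym (rowTail≡· λs i)))

  I-A-monotone : (∀ (λs : Vec ℤ k) → (∀ i → rowTail A λs i ≤ℤ lookup λs i) →
                   ∀ i → + 0 ≤ℤ lookup λs i) →
                 Monotone (I- A)
  I-A-monotone positivity x [I-A]x≥0 i =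
    subst (+ 0 ≤ℤ_) (lookup∘tabulate x i) (positivity (tabulate x) tail≤ i)
    where
    tail≤ : ∀ i → rowTail A (tabulate x) i ≤ℤ lookup (tabulate x) i
    tail≤ i = ℤ.0≤i-j⇒j≤i (subst (+ 0 ≤ℤ_) (trans (·-cong (I- A) (sym ∘ lookup∘tabulate x) i)
                                                   (I-A·≡ (tabulate x) i)) ([I-A]x≥0 i))

isInverseOfIMinus⇒rightInverse : ∀ {k} {A B : Matrix k} → IsInverseOfIMinus A B → RightInverse (I- A) B
isInverseOfIMinus⇒rightInverse {k} inv i j = trans (sym (sumℤ≡sum k _)) (inv i j)

≗-lookup⇒≡ : ∀ {k} {xs ys : Vec X k} → (∀ i → lookup xs i ≡ lookup ys i) → xs ≡ ys
≗-lookup⇒≡ {xs = xs} {ys} eq =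
  trans (sym (tabulate∘lookup xs)) (trans (tabulate-cong eq) (tabulate∘lookup ys))

-- Listing the terms of a Cauchy product

length-cartesianProductWith : ∀ {A B C : Set} (f : A → B → C) xs ys →
                              length (cartesianProductWith f xs ys) ≡ length xs ℕ.* length ys
length-cartesianProductWith f []       ys = refl
length-cartesianProductWith f (x ∷ xs) ys =
  trans (length-++ (map (f x) ys)) (cong₂ ℕ._+_ (length-map (f x) ys) (length-cartesianProductWith f xs ys))

concatFin : ∀ m → (Fin m → List X) → List X
concatFin zero    F = []
concatFin (suc m) F = F fzero ++ concatFin m (F ∘ fsuc)

length-concatFin : ∀ m (F : Fin m → List X) → length (concatFin m F) ≡ sumℕ m (length ∘ F)
length-concatFin zero    F = refl
length-concatFin (suc m) F =
  trans (length-++ (F fzero)) (cong (length (F fzero) ℕ.+_) (length-concatFin m (F ∘ fsuc)))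

∈-concatFin⁺ : ∀ {m} (F : Fin m → List X) {x} t → x ∈ F t → x ∈ concatFin m F
∈-concatFin⁺ F fzero    x∈ = ∈-++⁺ˡ x∈
∈-concatFin⁺ F (fsuc t) x∈ = ∈-++⁺ʳ (F fzero) (∈-concatFin⁺ (F ∘ fsuc) t x∈)

∈-concatFin⁻ : ∀ {m} (F : Fin m → List X) {x} → x ∈ concatFin m F → Σ (Fin m) λ t → x ∈ F t
∈-concatFin⁻ {m = suc m} F x∈ with ∈-++⁻ (F fzero) x∈
... | inj₁ x∈F₀ = fzero , x∈F₀
... | inj₂ x∈Fₛ = let t , x∈Fₜ = ∈-concatFin⁻ (F ∘ fsuc) x∈Fₛ in fsuc t , x∈Fₜ

concatFin⁺ : ∀ {m} (F : Fin m → List X) → (∀ t → Unique (F t)) →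
             (∀ t u {x} → x ∈ F t → x ∈ F u → t ≡ u) → Unique (concatFin m F)
concatFin⁺ {m = zero}  F unique disjoint = []
concatFin⁺ {m = suc m} F unique disjoint = Unique.++⁺ (unique fzero)
  (concatFin⁺ (F ∘ fsuc) (unique ∘ fsuc)
    (λ t u x∈ x∈′ → Fin.suc-injective (disjoint (fsuc t) (fsuc u) x∈ x∈′)))
  (λ (x∈F₀ , x∈rest) → let t , x∈Fₜ = ∈-concatFin⁻ (F ∘ fsuc) x∈rest in
                       Fin.0≢1+n (disjoint fzero (fsuc t) x∈F₀ x∈Fₜ))

infixr 5 _⊗_

_⊗_ : ∀ {k} → List X → List (Vec X k) → List (Vec X (suc k))
_⊗_ = cartesianProductWith _∷_

-- F i t lists the values of size t allowed in coordinate i.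
enumerate : ∀ k → (Fin k → ℕ → List X) → ℕ → List (Vec X k)
block : ∀ k → (Fin (suc k) → ℕ → List X) → ∀ n → Fin (suc n) → List (Vec X (suc k))

enumerate zero    F zero    = [ [] ]
enumerate zero    F (suc n) = []
enumerate (suc k) F n       = concatFin (suc n) (block k F n)

block k F n t = F fzero (toℕ t) ⊗ enumerate k (F ∘ fsuc) (n ∸ toℕ t)

HasSizes : ∀ k → (Fin k → ℕ → List X) → ℕ → Vec X k → Set
HasSizes k F n v = Σ (Fin k → ℕ) λ ts → (∀ i → lookup v i ∈ F i (ts i)) × sumℕ k ts ≡ n

length-enumerate : ∀ k F n → length (enumerate {X = X} k F n) ≡ prodS k (λ i t → length (F i t)) n
length-enumerate zero    F zero    = refl
length-enumerate zero    F (suc n) = refl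
length-enumerate (suc k) F n       =
  trans (length-concatFin (suc n) (block k F n)) (sumℕ-cong (suc n) length-block)
  where
  length-block : ∀ t → length (block k F n t) ≡
                 length (F fzero (toℕ t)) ℕ.* prodS k (λ i t → length (F (fsuc i) t)) (n ∸ toℕ t)
  length-block t =
    trans (length-cartesianProductWith _∷_ (F fzero (toℕ t)) (enumerate k (F ∘ fsuc) (n ∸ toℕ t)))
          (cong (length (F fzero (toℕ t)) ℕ.*_) (length-enumerate k (F ∘ fsuc) (n ∸ toℕ t)))

∈-enumerate⁻ : ∀ k F n {v : Vec X k} → v ∈ enumerate k F n → HasSizes k F n v
∈-enumerate⁻ zero    F zero    {[]} _ = (λ ()) , (λ ()) , refl
∈-enumerate⁻ (suc k) F n {x ∷ v} v∈
  with t , v∈block ← ∈-concatFin⁻ (block k F n) v∈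
  with _ , _ , x∈ , v∈rest , refl ← ∈-cartesianProductWith⁻ _∷_ (F fzero (toℕ t)) _ v∈block
  with ts , v∈F , Σts ← ∈-enumerate⁻ k (F ∘ fsuc) (n ∸ toℕ t) v∈rest
  = sizes , x∷v∈F , trans (cong (toℕ t ℕ.+_) Σts) (ℕ.m+[n∸m]≡n (ℕ.≤-pred (Fin.toℕ<n t)))
  where
  sizes : Fin (suc k) → ℕ
  sizes fzero    = toℕ t
  sizes (fsuc i) = ts i
  x∷v∈F : ∀ i → lookup (x ∷ v) i ∈ F i (sizes i)
  x∷v∈F fzero    = x∈
  x∷v∈F (fsuc i) = v∈F i

∈-enumerate⁺ : ∀ k F n {v : Vec X k} → HasSizes k F n v → v ∈ enumerate k F n
∈-enumerate⁺ zero    F zero    {[]} _ = here refl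
∈-enumerate⁺ (suc k) F n {x ∷ v} (ts , v∈F , Σts) =
  ∈-concatFin⁺ (block k F n) t
    (∈-cartesianProductWith⁺ _∷_ x∈
      (∈-enumerate⁺ k (F ∘ fsuc) (n ∸ toℕ t) (ts ∘ fsuc , v∈F ∘ fsuc , Σrest)))
  where
  t : Fin (suc n)
  t = fromℕ< (ℕ.s≤s (subst (ts fzero ≤_) Σts (ℕ.m≤m+n (ts fzero) _)))
  t≡ : toℕ t ≡ ts fzero
  t≡ = Fin.toℕ-fromℕ< _
  x∈ : x ∈ F fzero (toℕ t)
  x∈ = subst (λ s → x ∈ F fzero s) (sym t≡) (v∈F fzero)
  Σrest : sumℕ k (ts ∘ fsuc) ≡ n ∸ toℕ t
  Σrest = trans (sym (ℕ.m+n∸m≡n (ts fzero) _)) (cong₂ _∸_ Σts (sym t≡))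

enumerate⁺ : ∀ k (F : Fin k → ℕ → List X) → (∀ i t → Unique (F i t)) →
             (∀ i t u {x} → x ∈ F i t → x ∈ F i u → t ≡ u) → ∀ n → Unique (enumerate k F n)
enumerate⁺ zero    F unique disjoint zero    = [] ∷ []
enumerate⁺ zero    F unique disjoint (suc n) = []
enumerate⁺ (suc k) F unique disjoint n       = concatFin⁺ (block k F n)
  (λ t → Unique.cartesianProductWith⁺ _∷_ ∷-injective (unique fzero (toℕ t))
           (enumerate⁺ k (F ∘ fsuc) (unique ∘ fsuc) (disjoint ∘ fsuc) (n ∸ toℕ t)))
  blocks-disjoint
  where
  blocks-disjoint : ∀ t u {v} → v ∈ block k F n t → v ∈ block k F n u → t ≡ u
  blocks-disjoint t u v∈t v∈u
    with _ , _ , x∈t , _ , refl ← ∈-cartesianProductWith⁻ _∷_ (F fzero (toℕ t)) _ v∈t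
    with _ , _ , x∈u , _ , eq   ← ∈-cartesianProductWith⁻ _∷_ (F fzero (toℕ u)) _ v∈u
    = Fin.toℕ-injective
        (disjoint fzero _ _ x∈t (subst (_∈ F fzero (toℕ u)) (sym (proj₁ (∷-injective eq))) x∈u))

prodS-cong : ∀ k {F G : Fin k → Series} → (∀ i t → F i t ≡ G i t) →
             ∀ n → prodS k F n ≡ prodS k G n
prodS-cong zero    F≗G n = refl
prodS-cong (suc k) F≗G n = sumℕ-cong (suc n) λ m →
  cong₂ ℕ._*_ (F≗G fzero (toℕ m)) (prodS-cong k (F≗G ∘ fsuc) (n ∸ toℕ m))

zeroFibre : ℕ → List ℕ
zeroFibre zero    = [ 0 ]
zeroFibre (suc t) = []

quotients : ∀ {d t} → Dec (d ∣ t) → List ℕ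
quotients (yes (divides q _)) = [ q ]
quotients (no _)              = []

exactQuotient : ℤ → ℕ → List ℕ
exactQuotient (+ suc c) t = quotients (suc c ∣? t)
exactQuotient (+ zero)  t = []
exactQuotient -[1+ _ ]  t = []

length-zeroFibre : ∀ t → length (zeroFibre t) ≡ oneS t
length-zeroFibre zero    = refl
length-zeroFibre (suc t) = refl

length-quotients : ∀ {d t} (d∣?t : Dec (d ∣ t)) →
                   length (quotients d∣?t) ≡ (if does d∣?t then 1 else 0)
length-quotients (yes _) = refl
length-quotients (no _)  = refl

length-exactQuotient : ∀ b t → length (exactQuotient b t) ≡ geomInv b t
length-exactQuotient (+ suc c) t = length-quotients (suc c ∣? t)
length-exactQuotient (+ zero)  t = refl
length-exactQuotient -[1+ _ ]  t = refl

zeroFibre-unique : ∀ t → Unique (zeroFibre t)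
zeroFibre-unique zero    = [] ∷ []
zeroFibre-unique (suc t) = []

quotients-unique : ∀ {d t} (d∣?t : Dec (d ∣ t)) → Unique (quotients d∣?t)
quotients-unique (yes _) = [] ∷ []
quotients-unique (no _)  = []

exactQuotient-unique : ∀ b t → Unique (exactQuotient b t)
exactQuotient-unique (+ suc c) t = quotients-unique (suc c ∣? t)
exactQuotient-unique (+ zero)  t = []
exactQuotient-unique -[1+ _ ]  t = []

∈-zeroFibre⁻ : ∀ {t m} → m ∈ zeroFibre t → m ≡ 0 × t ≡ 0
∈-zeroFibre⁻ {zero} (here refl) = refl , refl

∈-quotients⁻ : ∀ {d t m} (d∣?t : Dec (d ∣ t)) → m ∈ quotients d∣?t → t ≡ m ℕ.* d
∈-quotients⁻ (yes (divides q eq)) (here refl) = eq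

∈-exactQuotient⁻ : ∀ b {t m} → m ∈ exactQuotient b t → b * + m ≡ + t
∈-exactQuotient⁻ (+ suc c) {t} {m} m∈ = trans (sym (ℤ.pos-* (suc c) m))
  (cong +_ (trans (ℕ.*-comm (suc c) m) (sym (∈-quotients⁻ (suc c ∣? t) m∈))))

∈-exactQuotient⁺ : ∀ c m → m ∈ exactQuotient (+ suc c) (suc c ℕ.* m)
∈-exactQuotient⁺ c m with suc c ∣? (suc c ℕ.* m)
... | yes (divides q eq) = here (ℕ.*-cancelʳ-≡ m q (suc c) (trans (ℕ.*-comm m (suc c)) eq))
... | no ∤              = contradiction (divides m (ℕ.*-comm (suc c) m)) ∤

module _ {k : ℕ} (S : Subset k) (b : Fin k → ℤ) where

  -- the values of μᵢ contributing q^t to the i-th factor of prodOutside S b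
  fibre : Fin k → ℕ → List ℕ
  fibre i = if does (i ∈? S) then zeroFibre else exactQuotient (b i)

  length-fibre : ∀ i t → length (fibre i t) ≡ (if does (i ∈? S) then oneS else geomInv (b i)) t
  length-fibre i t with does (i ∈? S)
  ... | true  = length-zeroFibre t
  ... | false = length-exactQuotient (b i) t

  fibre-unique : ∀ i t → Unique (fibre i t)
  fibre-unique i t with does (i ∈? S)
  ... | true  = zeroFibre-unique t
  ... | false = exactQuotient-unique (b i) t

  ∈-fibre⁻ : ∀ {i t m} → m ∈ fibre i t → b i * + m ≡ + t × (i ∈ₛ S → m ≡ 0)
  ∈-fibre⁻ {i} m∈ with i ∈? S
  ... | yes _  with refl , refl ← ∈-zeroFibre⁻ m∈ = ℤ.*-zeroʳ (b i) , λ _ → refl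
  ... | no i∉S = ∈-exactQuotient⁻ (b i) m∈ , λ i∈S → contradiction i∈S i∉S

  ∈-fibre⁺ : ∀ {i c m} → b i ≡ + suc c → (i ∈ₛ S → m ≡ 0) → m ∈ fibre i (suc c ℕ.* m)
  ∈-fibre⁺ {i} {c} b≡ m≡0 with i ∈? S
  ... | yes i∈S rewrite m≡0 i∈S | ℕ.*-zeroʳ c = here refl
  ... | no _    rewrite b≡ = ∈-exactQuotient⁺ c _

  fibre-disjoint : ∀ i t u {m} → m ∈ fibre i t → m ∈ fibre i u → t ≡ u
  fibre-disjoint i t u m∈t m∈u =
    ℤ.+-injective (trans (sym (proj₁ (∈-fibre⁻ {i} m∈t))) (proj₁ (∈-fibre⁻ {i} m∈u)))

-- The solutions λ = Bμ

module Solutions {k : ℕ} (A B : Matrix k) (A-upper : StrictlyUpperTriangular A)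
                 (mono : Monotone (I- A)) (inv : RightInverse (I- A) B) (S : Subset k) where

  b : Fin k → ℤ
  b = colSum B

  b-positive : ∀ j → Σ ℕ λ c → b j ≡ + suc c
  b-positive = colSum-positive (I- A) B mono inv

  residual : Vec ℤ k → Fin k → ℤ
  residual λs i = lookup λs i - rowTail A λs i

  solution : Vec ℕ k → Vec ℤ k
  solution μ = tabulate (B · (+_ ∘ lookup μ))

  solutions : ℕ → List (Vec ℤ k)
  solutions n = map solution (enumerate k (fibre S b) n)

  residual-solution : ∀ μ i → residual (solution μ) i ≡ + lookup μ i
  residual-solution μ i = begin
    residual (solution μ) i             ≡⟨ I-A·≡ A A-upper (solution μ) i ⟨
    ((I- A) · lookup (solution μ)) i    ≡⟨ ·-cong (I- A) (lookup∘tabulate _) i ⟩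
    ((I- A) · B · (+_ ∘ lookup μ)) i    ≡⟨ ·-rightInverse (I- A) B inv (+_ ∘ lookup μ) i ⟩
    + lookup μ i                        ∎
    where open ≡-Reasoning

  residual-injective : ∀ {λs νs} → (∀ i → residual λs i ≡ residual νs i) → λs ≡ νs
  residual-injective {λs} {νs} eq =
    ≗-lookup⇒≡ (monotone⇒injective (I- A) mono (lookup λs) (lookup νs) λ i →
      trans (I-A·≡ A A-upper λs i) (trans (eq i) (sym (I-A·≡ A A-upper νs i))))

  solution-injective : ∀ {μ ν} → solution μ ≡ solution ν → μ ≡ ν
  solution-injective {μ} {ν} eq = ≗-lookup⇒≡ λ i → ℤ.+-injective (begin
    + lookup μ i              ≡⟨ residual-solution μ i ⟨
    residual (solution μ) i   ≡⟨ cong (λ λs → residual λs i) eq ⟩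
    residual (solution ν) i   ≡⟨ residual-solution ν i ⟩
    + lookup ν i              ∎)
    where open ≡-Reasoning

  weight-solution : ∀ μ → weight (solution μ) ≡ sum (λ j → b j * + lookup μ j)
  weight-solution μ = weight-· B (+_ ∘ lookup μ)

  solutions-unique : ∀ n → Unique (solutions n)
  solutions-unique n = Unique.map⁺ solution-injective
    (enumerate⁺ k (fibre S b) (fibre-unique S b) (fibre-disjoint S b) n)

  length-solutions : ∀ n → length (solutions n) ≡ prodOutside S b n
  length-solutions n = begin
    length (solutions n)                         ≡⟨ length-map solution (enumerate k (fibre S b) n) ⟩
    length (enumerate k (fibre S b) n)           ≡⟨ length-enumerate k (fibre S b) n ⟩
    prodS k (λ i t → length (fibre S b i t)) n   ≡⟨ prodS-cong k (length-fibre S b) n ⟩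
    prodOutside S b n                            ∎
    where open ≡-Reasoning

  ∈-solutions⁻ : ∀ {n λs} → λs ∈ solutions n → InP A n S λs
  ∈-solutions⁻ {n} λs∈
    with μ , μ∈ , refl ← ∈-map⁻ solution λs∈
    with ts , μ∈fibre , Σts ← ∈-enumerate⁻ k (fibre S b) n μ∈
    = weight≡n , residual≡0 , residual≥0
    where
    weight≡n : weight (solution μ) ≡ + n
    weight≡n = begin
      weight (solution μ)              ≡⟨ weight-solution μ ⟩
      sum (λ j → b j * + lookup μ j)   ≡⟨ sum-cong-≗ (λ j → proj₁ (∈-fibre⁻ S b (μ∈fibre j))) ⟩
      sum (λ j → + ts j)               ≡⟨ sum-+ k ts ⟩
      + sumℕ k ts                      ≡⟨ cong +_ Σts ⟩
      + n                              ∎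
      where open ≡-Reasoning
    residual≡0 : ∀ i → i ∈ₛ S → lookup (solution μ) i ≡ rowTail A (solution μ) i
    residual≡0 i i∈S = ℤ.i-j≡0⇒i≡j _ _
      (trans (residual-solution μ i) (cong +_ (proj₂ (∈-fibre⁻ S b (μ∈fibre i)) i∈S)))
    residual≥0 : ∀ i → i ∉ S → rowTail A (solution μ) i ≤ℤ lookup (solution μ) i
    residual≥0 i _ =
      ℤ.0≤i-j⇒j≤i (subst (+ 0 ≤ℤ_) (sym (residual-solution μ i)) (ℤ.+≤+ ℕ.z≤n))

  ∈-solutions⁺ : ∀ {n λs} → InP A n S λs → λs ∈ solutions n
  ∈-solutions⁺ {n} {λs} (weight≡n , residual≡0 , residual≥0) = subst (_∈ solutions n) (sym λs≡)
    (∈-map⁺ solution (∈-enumerate⁺ k (fibre S b) n {μ} (ts , μ∈fibre , Σts)))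
    where
    nonneg : ∀ i → + 0 ≤ℤ residual λs i
    nonneg i with i ∈? S
    ... | yes i∈S = ℤ.≤-reflexive (sym (ℤ.i≡j⇒i-j≡0 (residual≡0 i i∈S)))
    ... | no i∉S  = ℤ.i≤j⇒0≤j-i (residual≥0 i i∉S)
    μ : Vec ℕ k
    μ = tabulate (λ i → ∣ residual λs i ∣)
    +μ≡residual : ∀ i → + lookup μ i ≡ residual λs i
    +μ≡residual i = trans (cong +_ (lookup∘tabulate _ i)) (ℤ.0≤i⇒+∣i∣≡i (nonneg i))
    λs≡ : λs ≡ solution μ
    λs≡ = residual-injective λ i → trans (sym (+μ≡residual i)) (sym (residual-solution μ i))
    c : Fin k → ℕ
    c i = proj₁ (b-positive i)
    ts : Fin k → ℕ
    ts i = suc (c i) ℕ.* lookup μ i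
    μ∈fibre : ∀ i → lookup μ i ∈ fibre S b i (ts i)
    μ∈fibre i = ∈-fibre⁺ S b (proj₂ (b-positive i)) λ i∈S →
      ℤ.+-injective (trans (+μ≡residual i) (ℤ.i≡j⇒i-j≡0 (residual≡0 i i∈S)))
    +ts≡ : ∀ i → + ts i ≡ b i * + lookup μ i
    +ts≡ i = trans (ℤ.pos-* (suc (c i)) _) (cong (_* + lookup μ i) (sym (proj₂ (b-positive i))))
    Σts : sumℕ k ts ≡ n
    Σts = ℤ.+-injective (begin
      + sumℕ k ts                      ≡⟨ sum-+ k ts ⟨
      sum (λ j → + ts j)               ≡⟨ sum-cong-≗ +ts≡ ⟩
      sum (λ j → b j * + lookup μ j)   ≡⟨ weight-solution μ ⟨
      weight (solution μ)              ≡⟨ cong weight λs≡ ⟨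
      weight λs                        ≡⟨ weight≡n ⟩
      + n                              ∎)
      where open ≡-Reasoning

corollary2 : (k : ℕ) → 1 ≤ k → (A : Matrix k) → StrictlyUpperTriangular A
    → (∀ (λs : Vec ℤ k) → (∀ (i : Fin k) → rowTail A λs i ≤ℤ lookup λs i)
         → ∀ (i : Fin k) → + 0 ≤ℤ lookup λs i)
    → (B : Matrix k) → IsInverseOfIMinus A B
    → (S : Subset k) → (n : ℕ)
    → Σ (List (Vec ℤ k)) (λ L →
         Unique L
         × (∀ (λs : Vec ℤ k) → (λs ∈ L) ⇔ InP A n S λs)
         × length L ≡ prodOutside S (colSum B) n)
corollary2 k _ A A-upper positivity B inv S n =
  solutions n , solutions-unique n , (λ λs → mk⇔ ∈-solutions⁻ ∈-solutions⁺) , length-solutions n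
  where
  open Solutions A B A-upper (I-A-monotone A A-upper positivity) (isInverseOfIMinus⇒rightInverse inv) S
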